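{- Let $p \geq 3$ be a prime and let $F$ be a one-dimensional cellular automaton over $\mathbb{Z}_p$ with diameter $d$ whose local rule is $f(x_1,\dots,x_{d+1})=\sum_{i=1}^{d+1} a_i x_i^{q_i}$ with $a_i\in\mathbb{Z}_p$ and nonnegative integers $q_i$. If all the $q_i$ are even positive integers, then $F$ is not injective.
   Context: A cellular automaton (CA) over the finite alphabet $A=\mathbb{Z}_m$ is a map $F:A^{\mathbb{Z}}\to A^{\mathbb{Z}}$ for which there are an integer radius $\rho\ge 0$ and a local rule $f:A^{2\rho+1}\to A$ with $F(x)_i=f(x_{i-\rho},\dots,x_{i+\rho})$ for all $x\in A^{\mathbb{Z}}$ and $i\in\mathbb{Z}$; $d=2\rho$ is the diameter, and the arguments of $f$ are indexed $x_1,\dots,x_{d+1}$. Arithmetic is modulo $m$ (here $m=p$). $F$ is injective if it is one-to-one as a map on $A^{\mathbb{Z}}$. -}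

module Defs where

open import Data.Nat using (ℕ; zero; suc; _+_; _*_; _^_; NonZero)
open import Data.Nat.DivMod using (_mod_)
open import Data.Fin using (Fin; toℕ) renaming (zero to fzero; suc to fsuc)
open import Data.Integer as ℤ using (ℤ; +_)
open import Relation.Binary.PropositionalEquality using (_≡_)

Config : ℕ → Set
Config p = ℤ → Fin p

_≈ᶜ_ : ∀ {p} → Config p → Config p → Set
x ≈ᶜ y = ∀ i → x i ≡ y i

sumFin : ∀ {n} → (Fin n → ℕ) → ℕ
sumFin {zero}  g = 0
sumFin {suc n} g = g fzero + sumFin (λ j → g (fsuc j))

polyRule : ∀ p .{{_ : NonZero p}} {n} → (a : Fin n → Fin p) → (q : Fin n → ℕ)
         → (Fin n → Fin p) → Fin p
polyRule p a q x = sumFin (λ j → toℕ (a j) * toℕ (x j) ^ q j) mod p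

-- The global map of the CA with radius ρ (diameter d = 2ρ) and local rule f:
-- F(x)_i = f(x_{i-ρ}, ..., x_{i+ρ}); the argument j : Fin (2ρ+1) (j = 0..2ρ)
-- is x_{i - ρ + j}.
globalMap : ∀ {p} (ρ : ℕ) → ((Fin (suc (2 * ρ)) → Fin p) → Fin p) → Config p → Config p
globalMap ρ f x i = f (λ j → x ((i ℤ.- + ρ) ℤ.+ + toℕ j))

module Submission where

open import Defs
open import Data.Nat using (ℕ; suc; _*_; _≤_; _<_; NonZero)
open import Data.Nat.Divisibility using (_∣_)
open import Data.Nat.Primality using (Prime)
open import Data.Fin using (Fin)
open import Function.Definitions using (Injective)
open import Relation.Nullary using (¬_)
open import Data.Product using (_×_)

open import Data.Nat using (zero; _+_; _^_; _%_; s≤s)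
open import Data.Nat.Properties using (^-*-assoc; *-comm; ≤-refl)
open import Data.Nat.DivMod using (_mod_; [m+kn]%n≡m%n; %-distribˡ-+; %-distribˡ-*)
open import Data.Nat.Divisibility using (divides)
open import Data.Nat.Solver using (module +-*-Solver)
open import Data.Fin using (toℕ; fromℕ<) renaming (zero to fzero; suc to fsuc)
open import Data.Fin.Properties using (toℕ-injective; toℕ-fromℕ<)
open import Data.Integer as ℤ using (+_)
open import Data.Product using (proj₂)
open import Relation.Binary.PropositionalEquality using (_≡_; refl; sym; trans; cong; cong₂; module ≡-Reasoning)

-- Even powers do not see the sign of a residue: if m + c = n then c ≡ -m (mod n), so every
-- rule Σ aᵢ xᵢ^qᵢ with all qᵢ even takes the same value on x and on -x.  The constant
-- configurations 1 and -1 are distinct as soon as n ≥ 3, hence have the same image.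

module _ {n : ℕ} .{{_ : NonZero n}} where

  %-cong-* : ∀ {a b c d} → a % n ≡ b % n → c % n ≡ d % n → (a * c) % n ≡ (b * d) % n
  %-cong-* {a} {b} {c} {d} a≡b c≡d = begin
    (a * c) % n               ≡⟨ %-distribˡ-* a c n ⟩
    ((a % n) * (c % n)) % n   ≡⟨ cong₂ (λ u v → (u * v) % n) a≡b c≡d ⟩
    ((b % n) * (d % n)) % n   ≡⟨ sym (%-distribˡ-* b d n) ⟩
    (b * d) % n               ∎
    where open ≡-Reasoning

  %-cong-^ : ∀ {a b} k → a % n ≡ b % n → (a ^ k) % n ≡ (b ^ k) % n
  %-cong-^ zero    a≡b = refl
  %-cong-^ (suc k) a≡b = %-cong-* a≡b (%-cong-^ k a≡b)

  sumFin-cong-% : ∀ {k} (g h : Fin k → ℕ) → (∀ j → g j % n ≡ h j % n) →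
                  sumFin g % n ≡ sumFin h % n
  sumFin-cong-% {zero}  g h g≡h = refl
  sumFin-cong-% {suc k} g h g≡h = begin
    (g fzero + sumFin (λ j → g (fsuc j))) % n                  ≡⟨ %-distribˡ-+ (g fzero) _ n ⟩
    (g fzero % n + sumFin (λ j → g (fsuc j)) % n) % n          ≡⟨ cong₂ (λ u v → (u + v) % n) (g≡h fzero) tail ⟩
    (h fzero % n + sumFin (λ j → h (fsuc j)) % n) % n          ≡⟨ sym (%-distribˡ-+ (h fzero) _ n) ⟩
    (h fzero + sumFin (λ j → h (fsuc j))) % n                  ∎
    where
    open ≡-Reasoning
    tail : sumFin (λ j → g (fsuc j)) % n ≡ sumFin (λ j → h (fsuc j)) % n
    tail = sumFin-cong-% (λ j → g (fsuc j)) (λ j → h (fsuc j)) (λ j → g≡h (fsuc j))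

  %-cong-mod : ∀ {a b} → a % n ≡ b % n → a mod n ≡ b mod n
  %-cong-mod a≡b = toℕ-injective (trans (toℕ-fromℕ< _) (trans a≡b (sym (toℕ-fromℕ< _))))

  ^2-complement-% : ∀ {m c} → m + c ≡ n → (c ^ 2) % n ≡ (m ^ 2) % n
  ^2-complement-% {m} {c} refl = begin
    (c ^ 2) % n                      ≡⟨ sym ([m+kn]%n≡m%n (c ^ 2) (2 * m) n) ⟩
    (c ^ 2 + 2 * m * (m + c)) % n    ≡⟨ cong (_% n) (expand m c) ⟩
    (m ^ 2 + (m + c) * (m + c)) % n  ≡⟨ [m+kn]%n≡m%n (m ^ 2) (m + c) n ⟩
    (m ^ 2) % n                      ∎
    where
    open ≡-Reasoning
    open +-*-Solver
    expand : ∀ m c → c ^ 2 + 2 * m * (m + c) ≡ m ^ 2 + (m + c) * (m + c)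
    expand = solve 2 (λ m c → c :^ 2 :+ con 2 :* m :* (m :+ c) := m :^ 2 :+ (m :+ c) :* (m :+ c)) refl

  even-^-complement-% : ∀ {m c e} → m + c ≡ n → 2 ∣ e → (c ^ e) % n ≡ (m ^ e) % n
  even-^-complement-% {m} {c} m+c≡n (divides k refl) = begin
    (c ^ (k * 2)) % n    ≡⟨ cong (_% n) (even-power c) ⟩
    ((c ^ 2) ^ k) % n    ≡⟨ %-cong-^ k (^2-complement-% {m} {c} m+c≡n) ⟩
    ((m ^ 2) ^ k) % n    ≡⟨ cong (_% n) (sym (even-power m)) ⟩
    (m ^ (k * 2)) % n    ∎
    where
    open ≡-Reasoning
    even-power : ∀ b → b ^ (k * 2) ≡ (b ^ 2) ^ k
    even-power b = trans (cong (b ^_) (*-comm k 2)) (sym (^-*-assoc b 2 k))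

polyRule-complement : ∀ n .{{_ : NonZero n}} {k} (a : Fin k → Fin n) (q : Fin k → ℕ) →
                      (∀ j → 2 ∣ q j) → (x y : Fin k → Fin n) →
                      (∀ j → toℕ (x j) + toℕ (y j) ≡ n) →
                      polyRule n a q x ≡ polyRule n a q y
polyRule-complement n a q q-even x y x+y≡n =
  %-cong-mod (sumFin-cong-% _ _ λ j →
    %-cong-* {a = toℕ (a j)} refl (sym (even-^-complement-% (x+y≡n j) (q-even j))))

globalMap-complement : ∀ n .{{_ : NonZero n}} ρ (a : Fin (suc (2 * ρ)) → Fin n) q →
                       (∀ j → 2 ∣ q j) → (x y : Config n) →
                       (∀ i → toℕ (x i) + toℕ (y i) ≡ n) →
                       globalMap ρ (polyRule n a q) x ≈ᶜ globalMap ρ (polyRule n a q) y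
globalMap-complement n ρ a q q-even x y x+y≡n i =
  polyRule-complement n a q q-even (window x) (window y) (λ j → x+y≡n _)
  where
  window : Config n → Fin (suc (2 * ρ)) → Fin n
  window z j = z ((i ℤ.- + ρ) ℤ.+ + toℕ j)

corollary2 : (p : ℕ) .{{_ : NonZero p}} → Prime p → 3 ≤ p →
    (ρ : ℕ) (a : Fin (suc (2 * ρ)) → Fin p) (q : Fin (suc (2 * ρ)) → ℕ) →
    (∀ i → 0 < q i × 2 ∣ q i) →
    ¬ Injective _≈ᶜ_ _≈ᶜ_ (globalMap ρ (polyRule p a q))
corollary2 (suc (suc (suc r))) _ (s≤s (s≤s (s≤s _))) ρ a q q-pos-even injective
  with injective {x = λ _ → one} {y = λ _ → minus-one} same-image (+ 0)
  where
  one minus-one : Fin (3 + r)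
  one       = fsuc fzero
  minus-one = fromℕ< {2 + r} ≤-refl
  same-image : globalMap ρ (polyRule (3 + r) a q) (λ _ → one) ≈ᶜ globalMap ρ (polyRule (3 + r) a q) (λ _ → minus-one)
  same-image = globalMap-complement (3 + r) ρ a q (λ j → proj₂ (q-pos-even j))
                 (λ _ → one) (λ _ → minus-one)
                 (λ _ → cong suc (toℕ-fromℕ< {2 + r} ≤-refl))
... | ()
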